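{- Let $k$ be a quadratic étale algebra over $\mathbb{Q}$ and $b,c\ge1$. Under the map $\Phi:S_k(b,c)/\!\sim\ \to\Omega_k(b,c)$, $[\mathfrak a,\beta]\mapsto\beta\mathfrak a^{ -3}$, each ideal in $\Omega_k(b,c)$ has exactly $|Cl_{k,c}^{(3)}|\cdot|\mathcal{O}_{k,c}^*/\mathcal{O}_{k,c}^{*3}|$ preimages.
   Context: $k$ is a quadratic field or $\mathbb{Q}\oplus\mathbb{Q}$, $\mathcal{O}_k$ its maximal order, $\mathcal{O}_{k,c}=\mathbb{Z}\cdot1+c\mathcal{O}_k$, $Cl_{k,c}$ the group of invertible fractional $\mathcal{O}_{k,c}$-ideals modulo principal ideals $\alpha\mathcal{O}_{k,c}$ ($\alpha\in k^*$), $\mathbf N$ the ideal norm (index for integral invertible ideals, extended multiplicatively). $S_k(b,c)$ is the set of pairs $(\mathfrak a,\beta)$ with $\mathfrak a$ an invertible $\mathcal{O}_{k,c}$-ideal, $\beta\in\mathfrak a^3$, $\mathbf N(\beta\mathfrak a^{ -3})=b$; $(\mathfrak a_1,\beta_1)\sim(\mathfrak a_2,\beta_2)$ iff $\rho\mathfrak a_1=\mathfrak a_2$, $\rho^3\beta_1=\beta_2$ for some $\rho\in k^*$. $\Omega_k(b,c)$ is the set of integral invertible $\mathcal{O}_{k,c}$-ideals $\mathfrak b$ with $\mathbf N\mathfrak b=b$ and $[\mathfrak b]\in Cl_{k,c}^3$ (the subgroup of cubes). $Cl_{k,c}^{(3)}=\{A\in Cl_{k,c}:A^3=1\}$. The map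 $\Phi$ is well defined. -}

module Defs where

open import Level using (Level; _⊔_; 0ℓ)
open import Data.Nat as ℕ using (ℕ; _≤_)
open import Data.Nat.Divisibility using (_∣_)
open import Data.Integer as ℤ using (ℤ; +_; ∣_∣)
open import Data.Rational as ℚ using (ℚ; _/_; 0ℚ; 1ℚ)
open import Data.Fin using (Fin)
open import Data.Product using (Σ; ∃; ∃-syntax; _×_; _,_)
open import Data.Sum using (_⊎_)
open import Data.List using (List; []; _∷_; foldr)
open import Data.List.Relation.Unary.All using (All)
open import Relation.Unary using (Pred; _∈_; _⊆_; _≐_)
open import Relation.Binary.PropositionalEquality using (_≡_)

-- Quadratic étale algebras over ℚ are, up to
-- isomorphism, exactly ℚ[ω]/(ω² - dω + (d²-d)/4) for d a fundamental
-- discriminant; d = 1 gives ℚ ⊕ ℚ, d ≠ 1 gives the field ℚ(√d).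

Squarefree : ℤ → Set
Squarefree z = ∀ (n : ℕ) → (n ℕ.* n) ∣ ∣ z ∣ → n ≡ 1

IsFundDisc : ℤ → Set
IsFundDisc d =
  (Squarefree d × ∃[ q ] d ≡ (+ 4) ℤ.* q ℤ.+ + 1)
  ⊎ ∃[ m ] (d ≡ (+ 4) ℤ.* m × Squarefree m ×
            ((∃[ q ] m ≡ (+ 4) ℤ.* q ℤ.+ + 2) ⊎ (∃[ q ] m ≡ (+ 4) ℤ.* q ℤ.+ + 3)))

-- The algebra k = ℚ ⊕ ℚω with ω = (d + √d)/2, so ω² = dω - (d²-d)/4.
-- An element (a , b) stands for a + bω.

K : Set
K = ℚ × ℚ

ι : ℤ → ℚ
ι z = z / 1

module Alg (d : ℤ) where

  t : ℚ
  t = (d ℤ.* d ℤ.- d) / 4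

  0K 1K : K
  0K = 0ℚ , 0ℚ
  1K = 1ℚ , 0ℚ

  infixl 6 _+K_ _-K_
  infixl 7 _*K_

  _+K_ : K → K → K
  (a , b) +K (c , e) = a ℚ.+ c , b ℚ.+ e

  _-K_ : K → K → K
  (a , b) -K (c , e) = a ℚ.- c , b ℚ.- e

  _*K_ : K → K → K
  (a , b) *K (c , e) =
    a ℚ.* c ℚ.- b ℚ.* e ℚ.* t , a ℚ.* e ℚ.+ b ℚ.* c ℚ.+ b ℚ.* e ℚ.* ι d

  cube : K → K
  cube x = x *K x *K x

  IsUnitK : K → Set
  IsUnitK α = ∃[ β ] α *K β ≡ 1K

  IsInt : ℚ → Set
  IsInt q = ∃[ z ] q ≡ ι z

  -- the order O_{k,c} = ℤ·1 + c·O_k = ℤ + ℤ(cω)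
  O : ℕ → Pred K 0ℓ
  O c (a , b) = IsInt a × ∃[ z ] b ≡ ι (+ c ℤ.* z)

  sumK : List K → K
  sumK = foldr _+K_ 0K

  infixl 7 _·_
  _·_ : Pred K 0ℓ → Pred K 0ℓ → Pred K 0ℓ
  (𝔞 · 𝔟) x = ∃[ L ] (All (λ p → Data.Product.proj₁ p ∈ 𝔞 × Data.Product.proj₂ p ∈ 𝔟) L
                     × x ≡ sumK (Data.List.map (λ p → Data.Product.proj₁ p *K Data.Product.proj₂ p) L))

  cubeI : Pred K 0ℓ → Pred K 0ℓ
  cubeI 𝔞 = 𝔞 · 𝔞 · 𝔞

  scale : K → Pred K 0ℓ → Pred K 0ℓ
  scale ρ 𝔞 x = ∃[ y ] (y ∈ 𝔞 × x ≡ ρ *K y)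

  principal : ℕ → K → Pred K 0ℓ
  principal c α = scale α (O c)

  IsFracIdeal : ℕ → Pred K 0ℓ → Set
  IsFracIdeal c 𝔞 =
    (0K ∈ 𝔞)
    × (∀ x y → x ∈ 𝔞 → y ∈ 𝔞 → (x +K y) ∈ 𝔞)
    × (∀ r x → r ∈ O c → x ∈ 𝔞 → (r *K x) ∈ 𝔞)
    × (∃[ m ] (1 ≤ m × (∀ x → x ∈ 𝔞 → ((ι (+ m) , 0ℚ) *K x) ∈ O c)))

  Invertible : ℕ → Pred K 0ℓ → Set₁
  Invertible c 𝔞 = IsFracIdeal c 𝔞 × ∃[ 𝔟 ] (IsFracIdeal c 𝔟 × (𝔞 · 𝔟) ≐ O c)

  -- 𝔞⁻¹ = (O_{k,c} : 𝔞), which is the inverse of 𝔞 when 𝔞 is invertible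
  inv : ℕ → Pred K 0ℓ → Pred K 0ℓ
  inv c 𝔞 x = ∀ y → y ∈ 𝔞 → (x *K y) ∈ O c

  -- 𝐍𝔟 = n for an integral ideal 𝔟: the index [O_{k,c} : 𝔟] equals n,
  -- i.e. O_{k,c}/𝔟 has exactly n cosets.
  HasNorm : ℕ → Pred K 0ℓ → ℕ → Set
  HasNorm c 𝔟 n =
    Σ (Fin n → K) λ f → ((∀ (i : Fin n) → f i ∈ O c)
           × (∀ (x : K) → x ∈ O c → Σ (Fin n) λ i → (x -K f i) ∈ 𝔟)
           × (∀ i j → (f i -K f j) ∈ 𝔟 → i ≡ j))

HasCard : {a p r : Level} {A : Set a} → (A → Set p) → (A → A → Set r) → ℕ → Set (a ⊔ p ⊔ r)
HasCard {A = A} P R n =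
  Σ (Fin n → A) λ f → ((∀ (i : Fin n) → P (f i))
         × (∀ (x : A) → P x → Σ (Fin n) λ i → R x (f i))
         × (∀ i j → R (f i) (f j) → i ≡ j))

module Objects (d : ℤ) where
  open Alg d

  InΩ : ℕ → ℕ → Pred K 0ℓ → Set₁
  InΩ b c 𝔟 =
    𝔟 ⊆ O c × Invertible c 𝔟 × HasNorm c 𝔟 b
    × ∃[ 𝔠 ] (Invertible c 𝔠 × ∃[ α ] (IsUnitK α × 𝔟 ≐ scale α (cubeI 𝔠)))

  Φ : ℕ → Pred K 0ℓ × K → Pred K 0ℓ
  Φ c (𝔞 , β) = scale β (cubeI (inv c 𝔞))

  InS : ℕ → ℕ → Pred K 0ℓ × K → Set₁
  InS b c (𝔞 , β) = Invertible c 𝔞 × β ∈ cubeI 𝔞 × HasNorm c (Φ c (𝔞 , β)) b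

  SEquiv : Pred K 0ℓ × K → Pred K 0ℓ × K → Set
  SEquiv (𝔞₁ , β₁) (𝔞₂ , β₂) = ∃[ ρ ] (IsUnitK ρ × scale ρ 𝔞₁ ≐ 𝔞₂ × cube ρ *K β₁ ≡ β₂)

  Fiber : ℕ → ℕ → Pred K 0ℓ → Pred K 0ℓ × K → Set₁
  Fiber b c 𝔟 x = InS b c x × Φ c x ≐ 𝔟

  Cl3 : ℕ → Pred K 0ℓ → Set₁
  Cl3 c 𝔞 = Invertible c 𝔞 × ∃[ α ] (IsUnitK α × cubeI 𝔞 ≐ principal c α)

  ClEq : Pred K 0ℓ → Pred K 0ℓ → Set
  ClEq 𝔞 𝔞' = ∃[ ρ ] (IsUnitK ρ × scale ρ 𝔞 ≐ 𝔞')

  UnitO : ℕ → K → Set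
  UnitO c u = u ∈ O c × ∃[ v ] (v ∈ O c × u *K v ≡ 1K)

  CubeEq : ℕ → K → K → Set
  CubeEq c u v = ∃[ w ] (UnitO c w × u ≡ v *K cube w)

-- Fix 𝔟 = α𝔠³. For (𝔞, β) in the fiber, 𝔞⁻³β = 𝔟 gives (𝔞𝔠)³ = (β/α), so 𝔞𝔠 has cube
-- class in Cl_{k,c}^{(3)}: some ρ𝔞𝔠 is one of the chosen representatives 𝔡ᵢ, with 𝔡ᵢ³ = (γᵢ).
-- Then ρ³β/(γᵢα) generates the unit ideal, so it is a unit of O_{k,c}, equal to a chosen εⱼ up
-- to a cube of a unit. Rescaling by that cube root, every fiber element is equivalent to
-- (𝔡ᵢ𝔠⁻¹, γᵢαεⱼ). These h·e pairs are pairwise inequivalent: an equivalence ρ between two of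
-- them makes 𝔡ᵢ and 𝔡ᵢ' equivalent, hence i = i'; then ρ is a unit and εⱼ, εⱼ' differ by ρ³.
-- The ideal computations all take place in the commutative monoid of O_{k,c}-submodules of k,
-- where invertible ideals can be cancelled.

module Submission where

open import Defs
open import Algebra.Bundles using (CommutativeMonoid)
import Algebra.Properties.CommutativeSemigroup as CommutativeSemigroupProperties
import Algebra.Properties.Monoid as MonoidProperties
import Algebra.Solver.CommutativeMonoid as CommutativeMonoidSolver
open import Data.Fin using (Fin; combine; remQuot)
open import Data.Fin.Properties using (combine-remQuot; remQuot-combine)
open import Data.Integer as ℤ using (ℤ; +_)
open import Data.Integer.Properties as ℤ using (*-zeroʳ; *-distribˡ-+; pos-*)
open import Data.Integer.Tactic.RingSolver as ℤ-Solver using ()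
open import Data.List using ([]; _∷_; _++_; map)
open import Data.List.Relation.Unary.All using (All; []; _∷_)
open import Data.List.Relation.Unary.All.Properties using (++⁺)
open import Data.Nat using (ℕ; _≤_; _*_)
open import Data.Nat.Properties using (*-mono-≤)
open import Data.Product using (Σ; ∃-syntax; _×_; _,_; proj₁; proj₂; uncurry)
open import Data.Product.Properties using (×-≡,≡→≡)
open import Data.Rational as ℚ using (ℚ; 0ℚ; 1ℚ; _/_; toℚᵘ)
open import Data.Rational.Properties as ℚ
  using (toℚᵘ-injective; toℚᵘ-fromℚᵘ; fromℚᵘ-cong; +-assoc; +-identityˡ; +-identityʳ)
import Data.Rational.Unnormalised as ℚᵘ
import Data.Rational.Unnormalised.Properties as ℚᵘ
open import Data.Sum using (inj₁; inj₂)
open import Level using (0ℓ) renaming (suc to lsuc)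
open import Relation.Binary.PropositionalEquality
  using (_≡_; refl; sym; trans; cong; cong₂; subst; isEquivalence; module ≡-Reasoning)
import Relation.Binary.Reasoning.Setoid
open import Relation.Binary.Structures using (IsEquivalence)
open import Relation.Nullary.Decidable using (dec⇒maybe)
open import Relation.Unary using (Pred; _∈_; _⊆_; _≐_)
open import Relation.Unary.Properties using (≐-refl; ≐-sym; ≐-trans)
open import Tactic.RingSolver using (solve-∀)
open import Tactic.RingSolver.Core.AlmostCommutativeRing
  using (AlmostCommutativeRing; fromCommutativeRing)

HasCard-* : ∀ {a p r} {A : Set a} {P : A → Set p} {R : A → A → Set r} {h e : ℕ}
  (f : Fin h → Fin e → A) → (∀ i j → P (f i j)) →
  (∀ x → P x → Σ (Fin h) λ i → Σ (Fin e) λ j → R x (f i j)) →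
  (∀ {i j i' j'} → R (f i j) (f i' j') → i ≡ i' × j ≡ j') →
  HasCard P R (h * e)
HasCard-* {P = P} {R} {h} {e} f f∈P classify distinct =
  (λ k → uncurry f (remQuot {h} e k)) , (λ k → f∈P _ _) , classify-flat , distinct-flat
  where
  classify-flat : ∀ x → P x → Σ (Fin (h * e)) λ k → R x (uncurry f (remQuot {h} e k))
  classify-flat x x∈P with classify x x∈P
  ... | i , j , xRf = combine i j , subst (λ ij → R x (uncurry f ij)) (sym (remQuot-combine i j)) xRf
  distinct-flat : ∀ k k' → R (uncurry f (remQuot {h} e k)) (uncurry f (remQuot {h} e k')) → k ≡ k'
  distinct-flat k k' r = begin
    k                                   ≡⟨ combine-remQuot {h} e k ⟨
    uncurry combine (remQuot {h} e k)   ≡⟨ cong (uncurry combine) (×-≡,≡→≡ (distinct r)) ⟩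
    uncurry combine (remQuot {h} e k')  ≡⟨ combine-remQuot {h} e k' ⟩
    k'                                  ∎
    where open ≡-Reasoning

module CubeLaws {a ℓ} (M : CommutativeMonoid a ℓ) where
  open CommutativeMonoid M renaming (refl to ≈-refl; trans to ≈-trans)
  open MonoidProperties monoid using (cancelʳ; insertʳ)
  open CommutativeSemigroupProperties commutativeSemigroup using (interchange)
  open CommutativeMonoidSolver M using (solve; _⊕_; _⊜_)
  open import Relation.Binary.Reasoning.Setoid setoid

  infix 10 _³
  _³ : Carrier → Carrier
  x ³ = x ∙ x ∙ x

  ³-cong : ∀ {x y} → x ≈ y → x ³ ≈ y ³
  ³-cong p = ∙-cong (∙-cong p p) p

  ³-distrib-∙ : ∀ x y → (x ∙ y) ³ ≈ x ³ ∙ y ³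
  ³-distrib-∙ = solve 2 (λ x y → ((x ⊕ y) ⊕ (x ⊕ y)) ⊕ (x ⊕ y) ⊜ ((x ⊕ x) ⊕ x) ⊕ ((y ⊕ y) ⊕ y)) ≈-refl

  inverse-comm : ∀ {x y} → x ∙ y ≈ ε → y ∙ x ≈ ε
  inverse-comm {x} {y} p = ≈-trans (comm y x) p

  inverse-∙ : ∀ {x x' y y'} → x ∙ x' ≈ ε → y ∙ y' ≈ ε → (x ∙ y) ∙ (x' ∙ y') ≈ ε
  inverse-∙ {x} {x'} {y} {y'} p q = ≈-trans (interchange x y x' y') (≈-trans (∙-cong p q) (identityˡ ε))

  inverse-³ : ∀ {x x'} → x ∙ x' ≈ ε → x ³ ∙ x' ³ ≈ ε
  inverse-³ p = inverse-∙ (inverse-∙ p p) p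

  ∙-cancelʳ : ∀ {x y y' z} → y ∙ y' ≈ ε → x ∙ y ≈ z ∙ y → x ≈ z
  ∙-cancelʳ {x} {y} {y'} {z} inv p = begin
    x             ≈⟨ insertʳ inv x ⟩
    (x ∙ y) ∙ y'  ≈⟨ ∙-congʳ p ⟩
    (z ∙ y) ∙ y'  ≈⟨ cancelʳ inv z ⟩
    z             ∎

-- Integers inside ℚ

ℚ-ring : AlmostCommutativeRing 0ℓ 0ℓ
ℚ-ring = fromCommutativeRing ℚ.+-*-commutativeRing (λ x → dec⇒maybe (0ℚ ℚ.≟ x))

toℚᵘ-ι : ∀ z → toℚᵘ (ι z) ℚᵘ.≃ ℚᵘ.mkℚᵘ z 0
toℚᵘ-ι z = toℚᵘ-fromℚᵘ (ℚᵘ.mkℚᵘ z 0)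

ι-+ : ∀ z w → ι z ℚ.+ ι w ≡ ι (z ℤ.+ w)
ι-+ z w = toℚᵘ-injective (ℚᵘ.≃-trans (ℚ.toℚᵘ-homo-+ (ι z) (ι w))
  (ℚᵘ.≃-trans (ℚᵘ.+-cong (toℚᵘ-ι z) (toℚᵘ-ι w))
  (ℚᵘ.≃-trans (ℚᵘ.*≡* (cross-multiplied z w)) (ℚᵘ.≃-sym (toℚᵘ-ι (z ℤ.+ w))))))
  where
  cross-multiplied : ∀ z w → (z ℤ.* + 1 ℤ.+ w ℤ.* + 1) ℤ.* + 1 ≡ (z ℤ.+ w) ℤ.* (+ 1 ℤ.* + 1)
  cross-multiplied = ℤ-Solver.solve-∀

ι-* : ∀ z w → ι z ℚ.* ι w ≡ ι (z ℤ.* w)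
ι-* z w = toℚᵘ-injective (ℚᵘ.≃-trans (ℚ.toℚᵘ-homo-* (ι z) (ι w))
  (ℚᵘ.≃-trans (ℚᵘ.*-cong (toℚᵘ-ι z) (toℚᵘ-ι w))
  (ℚᵘ.≃-trans (ℚᵘ.*≡* (cross-multiplied z w)) (ℚᵘ.≃-sym (toℚᵘ-ι (z ℤ.* w))))))
  where
  cross-multiplied : ∀ z w → z ℤ.* w ℤ.* + 1 ≡ z ℤ.* w ℤ.* (+ 1 ℤ.* + 1)
  cross-multiplied = ℤ-Solver.solve-∀

ι-‿- : ∀ z → ℚ.- ι z ≡ ι (ℤ.- z)
ι-‿- z = toℚᵘ-injective (ℚᵘ.≃-trans (ℚ.toℚᵘ-homo‿- (ι z))
  (ℚᵘ.≃-trans (ℚᵘ.-‿cong (toℚᵘ-ι z)) (ℚᵘ.≃-sym (toℚᵘ-ι (ℤ.- z)))))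

ι-- : ∀ z w → ι z ℚ.- ι w ≡ ι (z ℤ.- w)
ι-- z w = trans (cong (ι z ℚ.+_) (ι-‿- w)) (ι-+ z (ℤ.- w))

ι-/4 : ∀ z → ((+ 4) ℤ.* z) / 4 ≡ ι z
ι-/4 z = fromℚᵘ-cong {ℚᵘ.mkℚᵘ (+ 4 ℤ.* z) 3} {ℚᵘ.mkℚᵘ z 0} (ℚᵘ.*≡* (cross-multiplied z))
  where
  cross-multiplied : ∀ z → (+ 4) ℤ.* z ℤ.* + 1 ≡ z ℤ.* + 4
  cross-multiplied = ℤ-Solver.solve-∀

-- The algebra k and the order O_{k,c}

-- ω² = dω - t, so ω is integral (and O c a ring) exactly when t is an integer.
t-integral : ∀ {d} → IsFundDisc d → ∃[ T ] Alg.t d ≡ ι T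
t-integral (inj₁ (_ , q , refl)) =
  q ℤ.* (+ 4 ℤ.* q ℤ.+ + 1) , trans (cong (_/ 4) (four-divides q)) (ι-/4 (q ℤ.* (+ 4 ℤ.* q ℤ.+ + 1)))
  where
  four-divides : ∀ q → let d = + 4 ℤ.* q ℤ.+ + 1 in d ℤ.* d ℤ.- d ≡ + 4 ℤ.* (q ℤ.* d)
  four-divides = ℤ-Solver.solve-∀
t-integral (inj₂ (m , refl , _)) =
  + 4 ℤ.* m ℤ.* m ℤ.- m , trans (cong (_/ 4) (four-divides m)) (ι-/4 (+ 4 ℤ.* m ℤ.* m ℤ.- m))
  where
  four-divides : ∀ m → (+ 4 ℤ.* m) ℤ.* (+ 4 ℤ.* m) ℤ.- + 4 ℤ.* m ≡ + 4 ℤ.* (+ 4 ℤ.* m ℤ.* m ℤ.- m)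
  four-divides = ℤ-Solver.solve-∀

module KArithmetic (d : ℤ) where
  open Alg d

  *K-comm : ∀ x y → x *K y ≡ y *K x
  *K-comm (a , b) (c , e) = cong₂ _,_ (coord₁ a b c e t) (coord₂ a b c e (ι d))
    where
    coord₁ : ∀ a b c e t → a ℚ.* c ℚ.- b ℚ.* e ℚ.* t ≡ c ℚ.* a ℚ.- e ℚ.* b ℚ.* t
    coord₁ = solve-∀ ℚ-ring
    coord₂ : ∀ a b c e D → a ℚ.* e ℚ.+ b ℚ.* c ℚ.+ b ℚ.* e ℚ.* D ≡ c ℚ.* b ℚ.+ e ℚ.* a ℚ.+ e ℚ.* b ℚ.* D
    coord₂ = solve-∀ ℚ-ring

  *K-assoc : ∀ x y z → (x *K y) *K z ≡ x *K (y *K z)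
  *K-assoc (a , b) (c , e) (f , g) = cong₂ _,_ (coord₁ a b c e f g t (ι d)) (coord₂ a b c e f g t (ι d))
    where
    coord₁ : ∀ a b c e f g t D →
      (a ℚ.* c ℚ.- b ℚ.* e ℚ.* t) ℚ.* f ℚ.- (a ℚ.* e ℚ.+ b ℚ.* c ℚ.+ b ℚ.* e ℚ.* D) ℚ.* g ℚ.* t
      ≡ a ℚ.* (c ℚ.* f ℚ.- e ℚ.* g ℚ.* t) ℚ.- b ℚ.* (c ℚ.* g ℚ.+ e ℚ.* f ℚ.+ e ℚ.* g ℚ.* D) ℚ.* t
    coord₁ = solve-∀ ℚ-ring
    coord₂ : ∀ a b c e f g t D →
      (a ℚ.* c ℚ.- b ℚ.* e ℚ.* t) ℚ.* g ℚ.+ (a ℚ.* e ℚ.+ b ℚ.* c ℚ.+ b ℚ.* e ℚ.* D) ℚ.* f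
        ℚ.+ (a ℚ.* e ℚ.+ b ℚ.* c ℚ.+ b ℚ.* e ℚ.* D) ℚ.* g ℚ.* D
      ≡ a ℚ.* (c ℚ.* g ℚ.+ e ℚ.* f ℚ.+ e ℚ.* g ℚ.* D) ℚ.+ b ℚ.* (c ℚ.* f ℚ.- e ℚ.* g ℚ.* t)
        ℚ.+ b ℚ.* (c ℚ.* g ℚ.+ e ℚ.* f ℚ.+ e ℚ.* g ℚ.* D) ℚ.* D
    coord₂ = solve-∀ ℚ-ring

  *K-identityˡ : ∀ x → 1K *K x ≡ x
  *K-identityˡ (a , b) = cong₂ _,_ (coord₁ a b t) (coord₂ a b (ι d))
    where
    coord₁ : ∀ a b t → 1ℚ ℚ.* a ℚ.- 0ℚ ℚ.* b ℚ.* t ≡ a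
    coord₁ = solve-∀ ℚ-ring
    coord₂ : ∀ a b D → 1ℚ ℚ.* b ℚ.+ 0ℚ ℚ.* a ℚ.+ 0ℚ ℚ.* b ℚ.* D ≡ b
    coord₂ = solve-∀ ℚ-ring

  *K-identityʳ : ∀ x → x *K 1K ≡ x
  *K-identityʳ x = trans (*K-comm x 1K) (*K-identityˡ x)

  *K-zeroʳ : ∀ x → x *K 0K ≡ 0K
  *K-zeroʳ (a , b) = cong₂ _,_ (coord₁ a b t) (coord₂ a b (ι d))
    where
    coord₁ : ∀ a b t → a ℚ.* 0ℚ ℚ.- b ℚ.* 0ℚ ℚ.* t ≡ 0ℚ
    coord₁ = solve-∀ ℚ-ring
    coord₂ : ∀ a b D → a ℚ.* 0ℚ ℚ.+ b ℚ.* 0ℚ ℚ.+ b ℚ.* 0ℚ ℚ.* D ≡ 0ℚ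
    coord₂ = solve-∀ ℚ-ring

  *K-zeroˡ : ∀ x → 0K *K x ≡ 0K
  *K-zeroˡ x = trans (*K-comm 0K x) (*K-zeroʳ x)

  *K-distribˡ : ∀ x y z → x *K (y +K z) ≡ x *K y +K x *K z
  *K-distribˡ (a , b) (c , e) (f , g) = cong₂ _,_ (coord₁ a b c e f g t) (coord₂ a b c e f g (ι d))
    where
    coord₁ : ∀ a b c e f g t → a ℚ.* (c ℚ.+ f) ℚ.- b ℚ.* (e ℚ.+ g) ℚ.* t
      ≡ (a ℚ.* c ℚ.- b ℚ.* e ℚ.* t) ℚ.+ (a ℚ.* f ℚ.- b ℚ.* g ℚ.* t)
    coord₁ = solve-∀ ℚ-ring
    coord₂ : ∀ a b c e f g D → a ℚ.* (e ℚ.+ g) ℚ.+ b ℚ.* (c ℚ.+ f) ℚ.+ b ℚ.* (e ℚ.+ g) ℚ.* D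
      ≡ (a ℚ.* e ℚ.+ b ℚ.* c ℚ.+ b ℚ.* e ℚ.* D) ℚ.+ (a ℚ.* g ℚ.+ b ℚ.* f ℚ.+ b ℚ.* g ℚ.* D)
    coord₂ = solve-∀ ℚ-ring

  *K-distribʳ : ∀ x y z → (y +K z) *K x ≡ y *K x +K z *K x
  *K-distribʳ x y z = begin
    (y +K z) *K x       ≡⟨ *K-comm (y +K z) x ⟩
    x *K (y +K z)       ≡⟨ *K-distribˡ x y z ⟩
    x *K y +K x *K z    ≡⟨ cong₂ _+K_ (*K-comm x y) (*K-comm x z) ⟩
    y *K x +K z *K x    ∎
    where open ≡-Reasoning

  +K-assoc : ∀ x y z → (x +K y) +K z ≡ x +K (y +K z)
  +K-assoc (a , b) (c , e) (f , g) = cong₂ _,_ (ℚ.+-assoc a c f) (ℚ.+-assoc b e g)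

  +K-identityˡ : ∀ x → 0K +K x ≡ x
  +K-identityˡ (a , b) = cong₂ _,_ (ℚ.+-identityˡ a) (ℚ.+-identityˡ b)

  +K-identityʳ : ∀ x → x +K 0K ≡ x
  +K-identityʳ (a , b) = cong₂ _,_ (ℚ.+-identityʳ a) (ℚ.+-identityʳ b)

  *K-commutativeMonoid : CommutativeMonoid 0ℓ 0ℓ
  *K-commutativeMonoid = record
    { Carrier = K ; _≈_ = _≡_ ; _∙_ = _*K_ ; ε = 1K
    ; isCommutativeMonoid = record
      { isMonoid = record
        { isSemigroup = record
          { isMagma = record { isEquivalence = isEquivalence ; ∙-cong = cong₂ _*K_ }
          ; assoc = *K-assoc }
        ; identity = *K-identityˡ , *K-identityʳ }
      ; comm = *K-comm } }

  module KS = CommutativeMonoidSolver *K-commutativeMonoid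

module Order (d T : ℤ) (t≡ιT : Alg.t d ≡ ι T) (c : ℕ) where
  open Alg d

  O-0 : 0K ∈ O c
  O-0 = (+ 0 , refl) , (+ 0 , cong ι (sym (ℤ.*-zeroʳ (+ c))))

  O-1 : 1K ∈ O c
  O-1 = (+ 1 , refl) , (+ 0 , cong ι (sym (ℤ.*-zeroʳ (+ c))))

  O-+ : ∀ x y → x ∈ O c → y ∈ O c → (x +K y) ∈ O c
  O-+ _ _ ((a , refl) , (z , refl)) ((a' , refl) , (z' , refl)) =
    (a ℤ.+ a' , ι-+ a a') ,
    (z ℤ.+ z' , trans (ι-+ (+ c ℤ.* z) (+ c ℤ.* z')) (cong ι (sym (ℤ.*-distribˡ-+ (+ c) z z'))))

  O-* : ∀ x y → x ∈ O c → y ∈ O c → (x *K y) ∈ O c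
  O-* _ _ ((a , refl) , (z , refl)) ((a' , refl) , (z' , refl)) =
    (a ℤ.* a' ℤ.- cz ℤ.* cz' ℤ.* T , coord₁) , (a ℤ.* z' ℤ.+ z ℤ.* a' ℤ.+ + c ℤ.* z ℤ.* z' ℤ.* d , coord₂)
    where
    open ≡-Reasoning
    cz cz' : ℤ
    cz = + c ℤ.* z
    cz' = + c ℤ.* z'
    coord₁ : ι a ℚ.* ι a' ℚ.- ι cz ℚ.* ι cz' ℚ.* t ≡ ι (a ℤ.* a' ℤ.- cz ℤ.* cz' ℤ.* T)
    coord₁ = begin
      ι a ℚ.* ι a' ℚ.- ι cz ℚ.* ι cz' ℚ.* t
        ≡⟨ cong₂ (λ u v → u ℚ.- v ℚ.* t) (ι-* a a') (ι-* cz cz') ⟩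
      ι (a ℤ.* a') ℚ.- ι (cz ℤ.* cz') ℚ.* t
        ≡⟨ cong (λ v → ι (a ℤ.* a') ℚ.- v) (trans (cong (ι (cz ℤ.* cz') ℚ.*_) t≡ιT) (ι-* (cz ℤ.* cz') T)) ⟩
      ι (a ℤ.* a') ℚ.- ι (cz ℤ.* cz' ℤ.* T)
        ≡⟨ ι-- (a ℤ.* a') (cz ℤ.* cz' ℤ.* T) ⟩
      ι (a ℤ.* a' ℤ.- cz ℤ.* cz' ℤ.* T) ∎
    factor-c : ∀ C a a' z z' d →
      a ℤ.* (C ℤ.* z') ℤ.+ (C ℤ.* z) ℤ.* a' ℤ.+ (C ℤ.* z) ℤ.* (C ℤ.* z') ℤ.* d
      ≡ C ℤ.* (a ℤ.* z' ℤ.+ z ℤ.* a' ℤ.+ C ℤ.* z ℤ.* z' ℤ.* d)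
    factor-c = ℤ-Solver.solve-∀
    coord₂ : ι a ℚ.* ι cz' ℚ.+ ι cz ℚ.* ι a' ℚ.+ ι cz ℚ.* ι cz' ℚ.* ι d
             ≡ ι (+ c ℤ.* (a ℤ.* z' ℤ.+ z ℤ.* a' ℤ.+ + c ℤ.* z ℤ.* z' ℤ.* d))
    coord₂ = begin
      ι a ℚ.* ι cz' ℚ.+ ι cz ℚ.* ι a' ℚ.+ ι cz ℚ.* ι cz' ℚ.* ι d
        ≡⟨ cong₂ (λ u v → u ℚ.+ v ℚ.* ι d) (cong₂ ℚ._+_ (ι-* a cz') (ι-* cz a')) (ι-* cz cz') ⟩
      ι (a ℤ.* cz') ℚ.+ ι (cz ℤ.* a') ℚ.+ ι (cz ℤ.* cz') ℚ.* ι d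
        ≡⟨ cong₂ ℚ._+_ (ι-+ (a ℤ.* cz') (cz ℤ.* a')) (ι-* (cz ℤ.* cz') d) ⟩
      ι (a ℤ.* cz' ℤ.+ cz ℤ.* a') ℚ.+ ι (cz ℤ.* cz' ℤ.* d)
        ≡⟨ ι-+ (a ℤ.* cz' ℤ.+ cz ℤ.* a') (cz ℤ.* cz' ℤ.* d) ⟩
      ι (a ℤ.* cz' ℤ.+ cz ℤ.* a' ℤ.+ cz ℤ.* cz' ℤ.* d)
        ≡⟨ cong ι (factor-c (+ c) a a' z z' d) ⟩
      ι (+ c ℤ.* (a ℤ.* z' ℤ.+ z ℤ.* a' ℤ.+ + c ℤ.* z ℤ.* z' ℤ.* d)) ∎

-- The monoid of O_{k,c}-submodules of k

module Submodules (d T : ℤ) (t≡ιT : Alg.t d ≡ ι T) (c : ℕ) where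
  open Alg d
  open KArithmetic d
  open Order d T t≡ιT c
  open Objects d using (UnitO; Φ)

  IsAdditive : Pred K 0ℓ → Set
  IsAdditive X = (0K ∈ X) × (∀ x y → x ∈ X → y ∈ X → (x +K y) ∈ X)

  IsSubmodule : Pred K 0ℓ → Set
  IsSubmodule 𝔞 = (0K ∈ 𝔞) × (∀ x y → x ∈ 𝔞 → y ∈ 𝔞 → (x +K y) ∈ 𝔞)
                  × (∀ r x → r ∈ O c → x ∈ 𝔞 → (r *K x) ∈ 𝔞)

  private
    termProduct : K × K → K
    termProduct (a , b) = a *K b

    sumK-++ : ∀ L L' → sumK (map termProduct (L ++ L'))
                       ≡ sumK (map termProduct L) +K sumK (map termProduct L')
    sumK-++ [] L' = sym (+K-identityˡ _)
    sumK-++ (p ∷ L) L' = trans (cong (termProduct p +K_) (sumK-++ L L')) (sym (+K-assoc (termProduct p) _ _))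

  ·-least : ∀ {𝔞 𝔟 X} → IsAdditive X → (∀ a b → a ∈ 𝔞 → b ∈ 𝔟 → (a *K b) ∈ X) → (𝔞 · 𝔟) ⊆ X
  ·-least {𝔞} {𝔟} {X} (X-0 , X-+) ab∈X (L , L⊆𝔞×𝔟 , refl) = go L L⊆𝔞×𝔟
    where
    go : ∀ L → All (λ p → proj₁ p ∈ 𝔞 × proj₂ p ∈ 𝔟) L → sumK (map termProduct L) ∈ X
    go [] [] = X-0
    go ((a , b) ∷ L) ((a∈𝔞 , b∈𝔟) ∷ L⊆) = X-+ _ _ (ab∈X a b a∈𝔞 b∈𝔟) (go L L⊆)

  ·-additive : ∀ 𝔞 𝔟 → IsAdditive (𝔞 · 𝔟)
  ·-additive 𝔞 𝔟 = ([] , [] , refl) ,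
    λ { _ _ (L , L⊆ , refl) (L' , L'⊆ , refl) → L ++ L' , ++⁺ L⊆ L'⊆ , sym (sumK-++ L L') }

  *∈· : ∀ {𝔞 𝔟 a b} → a ∈ 𝔞 → b ∈ 𝔟 → (a *K b) ∈ (𝔞 · 𝔟)
  *∈· {a = a} {b} a∈𝔞 b∈𝔟 = ((a , b) ∷ []) , ((a∈𝔞 , b∈𝔟) ∷ []) , sym (+K-identityʳ _)

  ·-least-*ʳ : ∀ {𝔞 𝔟 X} e → IsAdditive X → (∀ a b → a ∈ 𝔞 → b ∈ 𝔟 → ((a *K b) *K e) ∈ X) →
               (𝔞 · 𝔟) ⊆ (λ s → (s *K e) ∈ X)
  ·-least-*ʳ {X = X} e (X-0 , X-+) = ·-least
    ( subst (_∈ X) (sym (*K-zeroˡ e)) X-0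
    , λ x y xe∈X ye∈X → subst (_∈ X) (sym (*K-distribʳ e x y)) (X-+ _ _ xe∈X ye∈X) )

  ·-mono : ∀ {𝔞 𝔞' 𝔟 𝔟'} → 𝔞 ⊆ 𝔞' → 𝔟 ⊆ 𝔟' → (𝔞 · 𝔟) ⊆ (𝔞' · 𝔟')
  ·-mono {𝔞' = 𝔞'} {𝔟' = 𝔟'} f g = ·-least (·-additive 𝔞' 𝔟') (λ a b a∈ b∈ → *∈· (f a∈) (g b∈))

  ·-cong : ∀ {𝔞 𝔞' 𝔟 𝔟'} → 𝔞 ≐ 𝔞' → 𝔟 ≐ 𝔟' → (𝔞 · 𝔟) ≐ (𝔞' · 𝔟')
  ·-cong (f , f⁻) (g , g⁻) = ·-mono f g , ·-mono f⁻ g⁻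

  ·-comm : ∀ 𝔞 𝔟 → (𝔞 · 𝔟) ⊆ (𝔟 · 𝔞)
  ·-comm 𝔞 𝔟 = ·-least (·-additive 𝔟 𝔞) λ a b a∈ b∈ → subst (_∈ (𝔟 · 𝔞)) (*K-comm b a) (*∈· b∈ a∈)

  ·-assoc : ∀ 𝔞 𝔟 𝔠 → ((𝔞 · 𝔟) · 𝔠) ⊆ (𝔞 · (𝔟 · 𝔠))
  ·-assoc 𝔞 𝔟 𝔠 = ·-least (·-additive 𝔞 (𝔟 · 𝔠)) λ s e s∈ e∈ →
    ·-least-*ʳ e (·-additive 𝔞 (𝔟 · 𝔠))
      (λ a b a∈ b∈ → subst (_∈ (𝔞 · (𝔟 · 𝔠))) (sym (*K-assoc a b e)) (*∈· a∈ (*∈· b∈ e∈))) s∈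

  ·-assoc≐ : ∀ 𝔞 𝔟 𝔠 → ((𝔞 · 𝔟) · 𝔠) ≐ (𝔞 · (𝔟 · 𝔠))
  ·-assoc≐ 𝔞 𝔟 𝔠 = ·-assoc 𝔞 𝔟 𝔠 , λ p →
    ·-comm _ _ (·-assoc 𝔠 𝔞 𝔟 (·-comm _ _ (·-assoc 𝔟 𝔠 𝔞 (·-comm 𝔞 (𝔟 · 𝔠) p))))

  O-isSubmodule : IsSubmodule (O c)
  O-isSubmodule = O-0 , O-+ , O-*

  ·-isSubmodule : ∀ {𝔞} 𝔟 → IsSubmodule 𝔞 → IsSubmodule (𝔞 · 𝔟)
  ·-isSubmodule {𝔞} 𝔟 (_ , _ , 𝔞-O) = proj₁ (·-additive 𝔞 𝔟) , proj₂ (·-additive 𝔞 𝔟) ,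
    λ r x r∈O x∈ → subst (_∈ (𝔞 · 𝔟)) (*K-comm x r)
      (·-least-*ʳ r (·-additive 𝔞 𝔟) (λ a b a∈ b∈ →
        subst (_∈ (𝔞 · 𝔟)) (rearrange r a b) (*∈· (𝔞-O r a r∈O a∈) b∈)) x∈)
    where
    rearrange : ∀ r a b → (r *K a) *K b ≡ (a *K b) *K r
    rearrange = KS.solve 3 (λ r a b → (r KS.⊕ a) KS.⊕ b KS.⊜ (a KS.⊕ b) KS.⊕ r) refl

  O·-identity : ∀ {𝔞} → IsSubmodule 𝔞 → (O c · 𝔞) ≐ 𝔞
  O·-identity {𝔞} (𝔞-0 , 𝔞-+ , 𝔞-O) =
    ·-least (𝔞-0 , 𝔞-+) 𝔞-O , λ {x} x∈ → subst (_∈ (O c · 𝔞)) (*K-identityˡ x) (*∈· O-1 x∈)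

  scale-cong : ∀ ρ {𝔞 𝔟} → 𝔞 ≐ 𝔟 → scale ρ 𝔞 ≐ scale ρ 𝔟
  scale-cong ρ (f , f⁻) = (λ (y , y∈ , eq) → y , f y∈ , eq) , (λ (y , y∈ , eq) → y , f⁻ y∈ , eq)

  scale≐principal· : ∀ ρ {𝔞} → IsSubmodule 𝔞 → scale ρ 𝔞 ≐ (principal c ρ · 𝔞)
  scale≐principal· ρ {𝔞} (𝔞-0 , 𝔞-+ , 𝔞-O) =
    (λ { (y , y∈ , refl) → subst (_∈ (principal c ρ · 𝔞)) (cong (_*K y) (*K-identityʳ ρ))
                              (*∈· (1K , O-1 , refl) y∈) }) ,
    ·-least ( (0K , 𝔞-0 , sym (*K-zeroʳ ρ))
            , λ { _ _ (x , x∈ , refl) (y , y∈ , refl) → x +K y , 𝔞-+ x y x∈ y∈ , sym (*K-distribˡ ρ x y) })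
            (λ { _ b (r , r∈O , refl) b∈ → r *K b , 𝔞-O r b r∈O b∈ , *K-assoc ρ r b })

  principal-isSubmodule : ∀ ρ → IsSubmodule (principal c ρ)
  principal-isSubmodule ρ =
    (0K , O-0 , sym (*K-zeroʳ ρ)) ,
    (λ { _ _ (x , x∈ , refl) (y , y∈ , refl) → x +K y , O-+ x y x∈ y∈ , sym (*K-distribˡ ρ x y) }) ,
    λ { r _ r∈O (y , y∈ , refl) → r *K y , O-* r y r∈O y∈ , rearrange r ρ y }
    where
    rearrange : ∀ r ρ y → r *K (ρ *K y) ≡ ρ *K (r *K y)
    rearrange = KS.solve 3 (λ r ρ y → r KS.⊕ (ρ KS.⊕ y) KS.⊜ ρ KS.⊕ (r KS.⊕ y)) refl

  principal-* : ∀ ρ σ → (principal c ρ · principal c σ) ≐ principal c (ρ *K σ)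
  principal-* ρ σ = ≐-trans (≐-sym (scale≐principal· ρ (principal-isSubmodule σ)))
    ( (λ { (_ , (z , z∈ , refl) , refl) → z , z∈ , sym (*K-assoc ρ σ z) })
    , (λ { (z , z∈ , refl) → σ *K z , (z , z∈ , refl) , *K-assoc ρ σ z }) )

  principal-1 : principal c 1K ≐ O c
  principal-1 = (λ { (y , y∈ , refl) → subst (_∈ O c) (sym (*K-identityˡ y)) y∈ }) ,
                λ {x} x∈ → x , x∈ , sym (*K-identityˡ x)

  unit⇒principal≐O : ∀ {u} → UnitO c u → principal c u ≐ O c
  unit⇒principal≐O {u} (u∈O , v , v∈O , uv≡1) =
    (λ { (y , y∈ , refl) → O-* u y u∈O y∈ }) ,
    λ {x} x∈ → v *K x , O-* v x v∈O x∈ , (begin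
      x               ≡⟨ sym (*K-identityˡ x) ⟩
      1K *K x         ≡⟨ cong (_*K x) (sym uv≡1) ⟩
      (u *K v) *K x   ≡⟨ *K-assoc u v x ⟩
      u *K (v *K x)   ∎)
    where open ≡-Reasoning

  principal≐O⇒unit : ∀ {u} → principal c u ≐ O c → UnitO c u
  principal≐O⇒unit {u} (f , f⁻) with f⁻ O-1
  ... | v , v∈O , 1≡uv = f (1K , O-1 , sym (*K-identityʳ u)) , v , v∈O , sym 1≡uv

  principal·⊆multiples : ∀ x 𝔈 → (principal c x · 𝔈) ⊆ (λ z → ∃[ y ] z ≡ x *K y)
  principal·⊆multiples x 𝔈 = ·-least
    ((0K , sym (*K-zeroʳ x)) , λ { _ _ (y , refl) (y' , refl) → y +K y' , sym (*K-distribˡ x y y') })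
    (λ { _ b (r , _ , refl) _ → r *K b , *K-assoc x r b })

  inv-unique : ∀ {𝔞 𝔟} → IsSubmodule 𝔟 → (𝔞 · 𝔟) ≐ O c → inv c 𝔞 ≐ 𝔟
  inv-unique {𝔞} {𝔟} (𝔟-0 , 𝔟-+ , 𝔟-O) (𝔞𝔟⊆O , O⊆𝔞𝔟) =
    (λ {x} x∈ → subst (_∈ 𝔟) (*K-identityʳ x)
       (·-least {X = λ s → (x *K s) ∈ 𝔟} (subst (_∈ 𝔟) (sym (*K-zeroʳ x)) 𝔟-0 ,
                 λ s s' xs∈ xs'∈ → subst (_∈ 𝔟) (sym (*K-distribˡ x s s')) (𝔟-+ _ _ xs∈ xs'∈))
         (λ a b a∈ b∈ → subst (_∈ 𝔟) (*K-assoc x a b) (𝔟-O (x *K a) b (x∈ a a∈) b∈))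
         (O⊆𝔞𝔟 O-1))) ,
    λ {x} x∈ y y∈ → 𝔞𝔟⊆O (subst (_∈ (𝔞 · 𝔟)) (*K-comm y x) (*∈· y∈ x∈))

  private
    emb : ℕ → K
    emb m = ι (+ m) , 0ℚ

    emb-* : ∀ m n → emb (m * n) ≡ emb m *K emb n
    emb-* m n = cong₂ _,_
      (trans (cong ι (pos-* m n)) (trans (sym (ι-* (+ m) (+ n))) (coord₁ (ι (+ m)) (ι (+ n)) t)))
      (coord₂ (ι (+ m)) (ι (+ n)) (ι d))
      where
      coord₁ : ∀ a b t → a ℚ.* b ≡ a ℚ.* b ℚ.- 0ℚ ℚ.* 0ℚ ℚ.* t
      coord₁ = solve-∀ ℚ-ring
      coord₂ : ∀ a b D → 0ℚ ≡ a ℚ.* 0ℚ ℚ.+ 0ℚ ℚ.* b ℚ.+ 0ℚ ℚ.* 0ℚ ℚ.* D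
      coord₂ = solve-∀ ℚ-ring

  ·-isFracIdeal : ∀ {𝔞 𝔟} → IsFracIdeal c 𝔞 → IsFracIdeal c 𝔟 → IsFracIdeal c (𝔞 · 𝔟)
  ·-isFracIdeal {𝔞} {𝔟} (𝔞-0 , 𝔞-+ , 𝔞-O , m , 1≤m , m𝔞⊆O) (_ , _ , _ , n , 1≤n , n𝔟⊆O) =
    let (·-0 , ·-+ , ·-O) = ·-isSubmodule 𝔟 (𝔞-0 , 𝔞-+ , 𝔞-O) in
    ·-0 , ·-+ , ·-O , m * n , *-mono-≤ 1≤m 1≤n ,
    λ x x∈ → subst (_∈ O c) (*K-comm x (emb (m * n))) (denominators-cleared x∈)
    where
    clear-denominators : ∀ a b → (emb m *K a) *K (emb n *K b) ≡ (a *K b) *K emb (m * n)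
    clear-denominators a b = trans
      (KS.solve 4 (λ M N a b → (M KS.⊕ a) KS.⊕ (N KS.⊕ b) KS.⊜ (a KS.⊕ b) KS.⊕ (M KS.⊕ N)) refl (emb m) (emb n) a b)
      (cong ((a *K b) *K_) (sym (emb-* m n)))
    denominators-cleared : (𝔞 · 𝔟) ⊆ (λ s → (s *K emb (m * n)) ∈ O c)
    denominators-cleared = ·-least-*ʳ (emb (m * n)) (O-0 , O-+)
      (λ a b a∈ b∈ → subst (_∈ O c) (clear-denominators a b) (O-* _ _ (m𝔞⊆O a a∈) (n𝔟⊆O b b∈)))

  HasNorm-resp-≐ : ∀ {𝔞 𝔟 n} → 𝔞 ≐ 𝔟 → HasNorm c 𝔞 n → HasNorm c 𝔟 n
  HasNorm-resp-≐ (f , f⁻) (rep , rep∈O , classify , distinct) =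
    rep , rep∈O , (λ x x∈ → proj₁ (classify x x∈) , f (proj₂ (classify x x∈))) , (λ i j p → distinct i j (f⁻ p))

  Submodule : Set₁
  Submodule = Σ (Pred K 0ℓ) IsSubmodule

  infix 4 _≈ₛ_
  record _≈ₛ_ (A B : Submodule) : Set where
    constructor ⟨_⟩
    field ≐-of : proj₁ A ≐ proj₁ B
  open _≈ₛ_ public

  -- Opaque, so that unification sees products of submodules rather than their unfolded carriers.
  infixl 7 _⊙_
  opaque
    _⊙_ : Submodule → Submodule → Submodule
    (𝔞 , 𝔞-sub) ⊙ (𝔟 , _) = 𝔞 · 𝔟 , ·-isSubmodule 𝔟 𝔞-sub

    ⊙≐· : ∀ A B → proj₁ (A ⊙ B) ≐ (proj₁ A · proj₁ B)
    ⊙≐· _ _ = ≐-refl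

  𝕆 : Submodule
  𝕆 = O c , O-isSubmodule

  ≈ₛ-isEquivalence : IsEquivalence _≈ₛ_
  ≈ₛ-isEquivalence = record
    { refl = ⟨ ≐-refl ⟩
    ; sym = λ A≈B → ⟨ ≐-sym (≐-of A≈B) ⟩
    ; trans = λ A≈B B≈C → ⟨ ≐-trans (≐-of A≈B) (≐-of B≈C) ⟩ }

  opaque
    unfolding _⊙_

    ⊙-cong : ∀ {A A' B B'} → A ≈ₛ A' → B ≈ₛ B' → A ⊙ B ≈ₛ A' ⊙ B'
    ⊙-cong A≈A' B≈B' = ⟨ ·-cong (≐-of A≈A') (≐-of B≈B') ⟩

    ⊙-assoc : ∀ A B C → (A ⊙ B) ⊙ C ≈ₛ A ⊙ (B ⊙ C)
    ⊙-assoc A B C = ⟨ ·-assoc≐ (proj₁ A) (proj₁ B) (proj₁ C) ⟩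

    ⊙-comm : ∀ A B → A ⊙ B ≈ₛ B ⊙ A
    ⊙-comm _ _ = ⟨ ·-comm _ _ , ·-comm _ _ ⟩

    ⊙-identityˡ : ∀ A → 𝕆 ⊙ A ≈ₛ A
    ⊙-identityˡ A = ⟨ O·-identity (proj₂ A) ⟩

  submoduleMonoid : CommutativeMonoid (lsuc 0ℓ) 0ℓ
  submoduleMonoid = record
    { Carrier = Submodule ; _≈_ = _≈ₛ_ ; _∙_ = _⊙_ ; ε = 𝕆
    ; isCommutativeMonoid = record
      { isMonoid = record
        { isSemigroup = record
          { isMagma = record { isEquivalence = ≈ₛ-isEquivalence ; ∙-cong = ⊙-cong }
          ; assoc = ⊙-assoc }
        ; identity = ⊙-identityˡ , λ A → IsEquivalence.trans ≈ₛ-isEquivalence (⊙-comm A 𝕆) (⊙-identityˡ A) }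
      ; comm = ⊙-comm } }

  [_] : K → Submodule
  [ x ] = principal c x , principal-isSubmodule x

  []-homo : ∀ x y → [ x *K y ] ≈ₛ [ x ] ⊙ [ y ]
  []-homo x y = ⟨ ≐-trans (≐-sym (principal-* x y)) (≐-sym (⊙≐· [ x ] [ y ])) ⟩

  []-cong : ∀ {x y} → x ≡ y → [ x ] ≈ₛ [ y ]
  []-cong refl = ⟨ ≐-refl ⟩

  [1]≈𝕆 : [ 1K ] ≈ₛ 𝕆
  [1]≈𝕆 = ⟨ principal-1 ⟩

  scale≈[]⊙ : ∀ ρ (A : Submodule) → scale ρ (proj₁ A) ≐ proj₁ ([ ρ ] ⊙ A)
  scale≈[]⊙ ρ A = ≐-trans (scale≐principal· ρ (proj₂ A)) (≐-sym (⊙≐· [ ρ ] A))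

  asSubmodule : ∀ {𝔞} → IsFracIdeal c 𝔞 → Submodule
  asSubmodule {𝔞} (𝔞-0 , 𝔞-+ , 𝔞-O , _) = 𝔞 , 𝔞-0 , 𝔞-+ , 𝔞-O

  inverseOf : ∀ {𝔞} → Invertible c 𝔞 → Submodule
  inverseOf (_ , _ , 𝔟-frac , _) = asSubmodule 𝔟-frac

  ⊙-inverseOf : ∀ {𝔞} (𝔞-inv : Invertible c 𝔞) → asSubmodule (proj₁ 𝔞-inv) ⊙ inverseOf 𝔞-inv ≈ₛ 𝕆
  ⊙-inverseOf (𝔞-frac , _ , 𝔟-frac , 𝔞𝔟≐O) = ⟨ ≐-trans (⊙≐· (asSubmodule 𝔞-frac) (asSubmodule 𝔟-frac)) 𝔞𝔟≐O ⟩

  module ⊙ = CommutativeMonoid submoduleMonoid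
  module ⊙-Reasoning = Relation.Binary.Reasoning.Setoid ⊙.setoid
  open CubeLaws submoduleMonoid public

  ·-represents : ∀ {𝔞 𝔟 A B} → 𝔞 ≐ proj₁ A → 𝔟 ≐ proj₁ B → (𝔞 · 𝔟) ≐ proj₁ (A ⊙ B)
  ·-represents {A = A} {B} 𝔞≐A 𝔟≐B = ≐-trans (·-cong 𝔞≐A 𝔟≐B) (≐-sym (⊙≐· A B))

  cubeI-represents : ∀ {𝔞 A} → 𝔞 ≐ proj₁ A → cubeI 𝔞 ≐ proj₁ (A ³)
  cubeI-represents 𝔞≐A = ·-represents (·-represents 𝔞≐A 𝔞≐A) 𝔞≐A

  scale≐⇒[]⊙≈ : ∀ {ρ 𝔞 A B} → 𝔞 ≐ proj₁ A → scale ρ 𝔞 ≐ proj₁ B → [ ρ ] ⊙ A ≈ₛ B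
  scale≐⇒[]⊙≈ {ρ} {A = A} 𝔞≐A ρ𝔞≐B = ⟨ ≐-trans (≐-sym (scale≈[]⊙ ρ A)) (≐-trans (scale-cong ρ (≐-sym 𝔞≐A)) ρ𝔞≐B) ⟩

  []⊙≈⇒scale≐ : ∀ {ρ 𝔞 A B} → 𝔞 ≐ proj₁ A → [ ρ ] ⊙ A ≈ₛ B → scale ρ 𝔞 ≐ proj₁ B
  []⊙≈⇒scale≐ {ρ} {A = A} 𝔞≐A ρA≈B = ≐-trans (scale-cong ρ 𝔞≐A) (≐-trans (scale≈[]⊙ ρ A) (≐-of ρA≈B))

  Φ≐[β]⊙inverse³ : ∀ {𝔞 A B} β → 𝔞 ≐ proj₁ A → A ⊙ B ≈ₛ 𝕆 → Φ c (𝔞 , β) ≐ proj₁ ([ β ] ⊙ B ³)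
  Φ≐[β]⊙inverse³ {B = B} β 𝔞≐A AB≈𝕆 = ≐-trans (scale-cong β (cubeI-represents inv≐B)) (scale≈[]⊙ β (B ³))
    where
    inv≐B = inv-unique (proj₂ B) (≐-trans (·-represents 𝔞≐A ≐-refl) (≐-of AB≈𝕆))

  ·-invertible : ∀ {𝔞 𝔟} → Invertible c 𝔞 → Invertible c 𝔟 → Invertible c (𝔞 · 𝔟)
  ·-invertible 𝔞-inv@(𝔞-frac , _ , 𝔞'-frac , _) 𝔟-inv@(𝔟-frac , _ , 𝔟'-frac , _) =
    ·-isFracIdeal 𝔞-frac 𝔟-frac , _ , ·-isFracIdeal 𝔞'-frac 𝔟'-frac ,
    ≐-trans (·-represents (·-represents ≐-refl ≐-refl) (·-represents ≐-refl ≐-refl))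
            (≐-of (inverse-∙ (⊙-inverseOf 𝔞-inv) (⊙-inverseOf 𝔟-inv)))

  []-inverse : ∀ x x' → x *K x' ≡ 1K → [ x ] ⊙ [ x' ] ≈ₛ 𝕆
  []-inverse x x' xx'≡1 = ⊙.trans (⊙.sym ([]-homo x x')) (⊙.trans ([]-cong xx'≡1) [1]≈𝕆)

  unit⇒[]≈𝕆 : ∀ {u} → UnitO c u → [ u ] ≈ₛ 𝕆
  unit⇒[]≈𝕆 u-unit = ⟨ unit⇒principal≐O u-unit ⟩

  []≈𝕆⇒unit : ∀ {u} → [ u ] ≈ₛ 𝕆 → UnitO c u
  []≈𝕆⇒unit [u]≈𝕆 = principal≐O⇒unit (≐-of [u]≈𝕆)

  []≈⇒unit-ratio : ∀ x y y' → [ x ] ≈ₛ [ y ] → y *K y' ≡ 1K → UnitO c (x *K y')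
  []≈⇒unit-ratio x y y' [x]≈[y] yy'≡1 = []≈𝕆⇒unit (begin
    [ x *K y' ]      ≈⟨ []-homo x y' ⟩
    [ x ] ⊙ [ y' ]   ≈⟨ ⊙.∙-congʳ {[ y' ]} [x]≈[y] ⟩
    [ y ] ⊙ [ y' ]   ≈⟨ []-inverse y y' yy'≡1 ⟩
    𝕆                ∎)
    where open ⊙-Reasoning

  []⊙≈𝕆⇒unit : ∀ x A → [ x ] ⊙ A ≈ₛ 𝕆 → IsUnitK x
  []⊙≈𝕆⇒unit x A xA≈𝕆 = proj₁ x∣1 , sym (proj₂ x∣1)
    where
    x∣1 : ∃[ y ] 1K ≡ x *K y
    x∣1 = principal·⊆multiples x (proj₁ A) (proj₁ (⊙≐· [ x ] A) (proj₂ (≐-of xA≈𝕆) O-1))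

  x∈[x] : ∀ x → x ∈ proj₁ [ x ]
  x∈[x] x = 1K , O-1 , sym (*K-identityʳ x)

  []-cube : ∀ x → [ cube x ] ≈ₛ [ x ] ³
  []-cube x = ⊙.trans ([]-homo (x *K x) x) (⊙.∙-congʳ {[ x ]} ([]-homo x x))

  *∈⊙ : ∀ {a b} A B → a ∈ proj₁ A → b ∈ proj₁ B → (a *K b) ∈ proj₁ (A ⊙ B)
  *∈⊙ A B a∈ b∈ = proj₂ (⊙≐· A B) (*∈· a∈ b∈)

  ⊙-monoˡ : ∀ {A A'} B → proj₁ A ⊆ proj₁ A' → proj₁ (A ⊙ B) ⊆ proj₁ (A' ⊙ B)
  ⊙-monoˡ {A} {A'} B A⊆A' p = proj₂ (⊙≐· A' B) (·-mono A⊆A' (λ b∈ → b∈) (proj₁ (⊙≐· A B) p))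

  inverse-invertible : ∀ {𝔞} (𝔞-inv : Invertible c 𝔞) → Invertible c (proj₁ (inverseOf 𝔞-inv))
  inverse-invertible {𝔞} (𝔞-frac , _ , 𝔟-frac , 𝔞𝔟≐O) = 𝔟-frac , 𝔞 , 𝔞-frac , ≐-trans (·-comm _ _ , ·-comm _ _) 𝔞𝔟≐O

-- The fiber of Φ

module Counting (d T : ℤ) (t≡ιT : Alg.t d ≡ ι T) (c : ℕ) where
  open Alg d
  open KArithmetic d
  open Submodules d T t≡ιT c
  open Objects d
  module ⊙S = CommutativeMonoidSolver submoduleMonoid
  module K* = CubeLaws *K-commutativeMonoid
  open MonoidProperties ⊙.monoid using (cancelʳ; elimʳ; elimˡ; insertˡ; insertʳ)
  module K*P = MonoidProperties (CommutativeMonoid.monoid *K-commutativeMonoid)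

  module _ (b : ℕ) (𝔟 : Pred K 0ℓ) (𝔟⊆O : 𝔟 ⊆ O c) (𝔟-frac : IsFracIdeal c 𝔟) (𝔟-norm : HasNorm c 𝔟 b)
           (𝔠 : Pred K 0ℓ) (𝔠-inv : Invertible c 𝔠) (α α' : K) (αα'≡1 : α *K α' ≡ 1K)
           (𝔟≐α𝔠³ : 𝔟 ≐ scale α (cubeI 𝔠))
           {h : ℕ} (𝔡 : Fin h → Pred K 0ℓ) (𝔡∈Cl3 : ∀ i → Cl3 c (𝔡 i))
           (classify-Cl3 : ∀ 𝔞 → Cl3 c 𝔞 → Σ (Fin h) λ i → ClEq 𝔞 (𝔡 i))
           (𝔡-distinct : ∀ i j → ClEq (𝔡 i) (𝔡 j) → i ≡ j)
           {e : ℕ} (ε : Fin e → K) (ε∈O* : ∀ j → UnitO c (ε j))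
           (classify-O* : ∀ u → UnitO c u → Σ (Fin e) λ j → CubeEq c u (ε j))
           (ε-distinct : ∀ i j → CubeEq c (ε i) (ε j) → i ≡ j) where

    B C C' : Submodule
    B = asSubmodule 𝔟-frac
    C = asSubmodule (proj₁ 𝔠-inv)
    C' = inverseOf 𝔠-inv

    CC'≈𝕆 : C ⊙ C' ≈ₛ 𝕆
    CC'≈𝕆 = ⊙-inverseOf 𝔠-inv

    B≈[α]C³ : B ≈ₛ [ α ] ⊙ C ³
    B≈[α]C³ = ⟨ ≐-trans 𝔟≐α𝔠³ (≐-trans (scale-cong α (cubeI-represents ≐-refl)) (scale≈[]⊙ α (C ³))) ⟩

    D D' : Fin h → Submodule
    D i = asSubmodule (proj₁ (proj₁ (𝔡∈Cl3 i)))
    D' i = inverseOf (proj₁ (𝔡∈Cl3 i))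

    DD'≈𝕆 : ∀ i → D i ⊙ D' i ≈ₛ 𝕆
    DD'≈𝕆 i = ⊙-inverseOf (proj₁ (𝔡∈Cl3 i))

    γ γ' : Fin h → K
    γ i = proj₁ (proj₂ (𝔡∈Cl3 i))
    γ' i = proj₁ (proj₁ (proj₂ (proj₂ (𝔡∈Cl3 i))))

    γγ'≡1 : ∀ i → γ i *K γ' i ≡ 1K
    γγ'≡1 i = proj₂ (proj₁ (proj₂ (proj₂ (𝔡∈Cl3 i))))

    D³≈[γ] : ∀ i → D i ³ ≈ₛ [ γ i ]
    D³≈[γ] i = ⟨ ≐-trans (≐-sym (cubeI-represents ≐-refl)) (proj₂ (proj₂ (proj₂ (𝔡∈Cl3 i)))) ⟩

    g g' : Fin h → K
    g i = γ i *K α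
    g' i = γ' i *K α'

    gg'≡1 : ∀ i → g i *K g' i ≡ 1K
    gg'≡1 i = K*.inverse-∙ {γ i} {γ' i} {α} {α'} (γγ'≡1 i) αα'≡1

    g'g≡1 : ∀ i → g' i *K g i ≡ 1K
    g'g≡1 i = trans (*K-comm (g' i) (g i)) (gg'≡1 i)

    [g]≈D³[α] : ∀ i → [ g i ] ≈ₛ D i ³ ⊙ [ α ]
    [g]≈D³[α] i = ⊙.trans ([]-homo (γ i) α) (⊙.∙-congʳ (⊙.sym (D³≈[γ] i)))

    -- The representatives (𝔡ᵢ𝔠⁻¹, γᵢαεⱼ), where 𝔡ᵢ³ = (γᵢ) and 𝔟 = α𝔠³.
    𝔞ᵣ : Fin h → Pred K 0ℓ
    𝔞ᵣ i = 𝔡 i · proj₁ C'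

    Aᵣ : Fin h → Submodule
    Aᵣ i = D i ⊙ C'

    𝔞ᵣ≐Aᵣ : ∀ i → 𝔞ᵣ i ≐ proj₁ (Aᵣ i)
    𝔞ᵣ≐Aᵣ i = ·-represents ≐-refl ≐-refl

    βᵣ : Fin h → Fin e → K
    βᵣ i j = g i *K ε j

    Aᵣ-inverse : ∀ i → Aᵣ i ⊙ (D' i ⊙ C) ≈ₛ 𝕆
    Aᵣ-inverse i = inverse-∙ (DD'≈𝕆 i) (inverse-comm CC'≈𝕆)

    [α]≈BC'³ : [ α ] ≈ₛ B ⊙ C' ³
    [α]≈BC'³ = begin
      [ α ]                    ≈⟨ cancelʳ (inverse-³ CC'≈𝕆) [ α ] ⟨
      ([ α ] ⊙ C ³) ⊙ C' ³     ≈⟨ ⊙.∙-congʳ B≈[α]C³ ⟨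
      B ⊙ C' ³                 ∎
      where open ⊙-Reasoning

    α∈C'³ : α ∈ proj₁ (C' ³)
    α∈C'³ = proj₁ (≐-of (⊙.identityˡ (C' ³)))
              (⊙-monoˡ (C' ³) 𝔟⊆O (proj₁ (≐-of [α]≈BC'³) (x∈[x] α)))

    βᵣ∈𝔞ᵣ³ : ∀ i j → βᵣ i j ∈ cubeI (𝔞ᵣ i)
    βᵣ∈𝔞ᵣ³ i j = proj₂ (cubeI-represents (𝔞ᵣ≐Aᵣ i)) (proj₁ (≐-of [γ]C'³≈Aᵣ³)
      (subst (_∈ proj₁ ([ γ i ] ⊙ C' ³)) (sym (*K-assoc (γ i) α (ε j)))
        (*∈⊙ [ γ i ] (C' ³) (x∈[x] (γ i)) αε∈C'³)))
      where
      αε∈C'³ : (α *K ε j) ∈ proj₁ (C' ³)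
      αε∈C'³ = subst (_∈ proj₁ (C' ³)) (*K-comm (ε j) α)
                 (proj₂ (proj₂ (proj₂ (C' ³))) (ε j) α (proj₁ (ε∈O* j)) α∈C'³)
      [γ]C'³≈Aᵣ³ : [ γ i ] ⊙ C' ³ ≈ₛ Aᵣ i ³
      [γ]C'³≈Aᵣ³ = ⊙.trans (⊙.∙-congʳ (⊙.sym (D³≈[γ] i))) (⊙.sym (³-distrib-∙ (D i) C'))

    Φᵣ≐𝔟 : ∀ i j → Φ c (𝔞ᵣ i , βᵣ i j) ≐ 𝔟
    Φᵣ≐𝔟 i j = ≐-trans (Φ≐[β]⊙inverse³ (βᵣ i j) (𝔞ᵣ≐Aᵣ i) (Aᵣ-inverse i)) (≐-of (begin
      [ g i *K ε j ] ⊙ (D' i ⊙ C) ³     ≈⟨ ⊙.∙-congʳ ([]-homo (g i) (ε j)) ⟩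
      ([ g i ] ⊙ [ ε j ]) ⊙ (D' i ⊙ C) ³ ≈⟨ ⊙.∙-congʳ (elimʳ (unit⇒[]≈𝕆 (ε∈O* j)) [ g i ]) ⟩
      [ g i ] ⊙ (D' i ⊙ C) ³            ≈⟨ ⊙.∙-congʳ ([g]≈D³[α] i) ⟩
      (D i ³ ⊙ [ α ]) ⊙ (D' i ⊙ C) ³    ≈⟨ regroup (D i) [ α ] (D' i) C ⟩
      (D i ³ ⊙ D' i ³) ⊙ ([ α ] ⊙ C ³)  ≈⟨ elimˡ (inverse-³ (DD'≈𝕆 i)) _ ⟩
      [ α ] ⊙ C ³                       ≈⟨ B≈[α]C³ ⟨
      B                                 ∎))
      where
      open ⊙-Reasoning
      regroup : ∀ x a y z → (x ³ ⊙ a) ⊙ (y ⊙ z) ³ ≈ₛ (x ³ ⊙ y ³) ⊙ (a ⊙ z ³)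
      regroup = ⊙S.solve 4 (λ x a y z →
        (((x ⊙S.⊕ x) ⊙S.⊕ x) ⊙S.⊕ a) ⊙S.⊕ (((y ⊙S.⊕ z) ⊙S.⊕ (y ⊙S.⊕ z)) ⊙S.⊕ (y ⊙S.⊕ z))
        ⊙S.⊜ (((x ⊙S.⊕ x) ⊙S.⊕ x) ⊙S.⊕ ((y ⊙S.⊕ y) ⊙S.⊕ y)) ⊙S.⊕ (a ⊙S.⊕ ((z ⊙S.⊕ z) ⊙S.⊕ z))) ⊙.refl

    representative∈Fiber : ∀ i j → Fiber b c 𝔟 (𝔞ᵣ i , βᵣ i j)
    representative∈Fiber i j =
      (·-invertible (proj₁ (𝔡∈Cl3 i)) (inverse-invertible 𝔠-inv) , βᵣ∈𝔞ᵣ³ i j ,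
       HasNorm-resp-≐ (≐-sym (Φᵣ≐𝔟 i j)) 𝔟-norm) ,
      Φᵣ≐𝔟 i j

    module Classification {𝔞 : Pred K 0ℓ} {β : K} (𝔞-inv : Invertible c 𝔞) (Φ≐𝔟 : Φ c (𝔞 , β) ≐ 𝔟) where
      A A' : Submodule
      A = asSubmodule (proj₁ 𝔞-inv)
      A' = inverseOf 𝔞-inv

      AA'≈𝕆 : A ⊙ A' ≈ₛ 𝕆
      AA'≈𝕆 = ⊙-inverseOf 𝔞-inv

      [β]A'³≈[α]C³ : [ β ] ⊙ A' ³ ≈ₛ [ α ] ⊙ C ³
      [β]A'³≈[α]C³ = ⟨ ≐-trans (≐-sym (Φ≐[β]⊙inverse³ β ≐-refl AA'≈𝕆)) (≐-trans Φ≐𝔟 (≐-of B≈[α]C³)) ⟩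

      AC³≈[βα'] : (A ⊙ C) ³ ≈ₛ [ β *K α' ]
      AC³≈[βα'] = begin
        (A ⊙ C) ³                            ≈⟨ ³-distrib-∙ A C ⟩
        A ³ ⊙ C ³                            ≈⟨ ⊙.∙-congˡ (insertˡ (inverse-comm ([]-inverse α α' αα'≡1)) (C ³)) ⟩
        A ³ ⊙ ([ α' ] ⊙ ([ α ] ⊙ C ³))       ≈⟨ ⊙.∙-congˡ (⊙.∙-congˡ [β]A'³≈[α]C³) ⟨
        A ³ ⊙ ([ α' ] ⊙ ([ β ] ⊙ A' ³))      ≈⟨ regroup A [ α' ] [ β ] A' ⟩
        ([ β ] ⊙ [ α' ]) ⊙ (A ³ ⊙ A' ³)      ≈⟨ elimʳ (inverse-³ AA'≈𝕆) _ ⟩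
        [ β ] ⊙ [ α' ]                       ≈⟨ []-homo β α' ⟨
        [ β *K α' ]                          ∎
        where
        open ⊙-Reasoning
        regroup : ∀ x a b y → x ³ ⊙ (a ⊙ (b ⊙ y ³)) ≈ₛ (b ⊙ a) ⊙ (x ³ ⊙ y ³)
        regroup = ⊙S.solve 4 (λ x a b y →
          ((x ⊙S.⊕ x) ⊙S.⊕ x) ⊙S.⊕ (a ⊙S.⊕ (b ⊙S.⊕ ((y ⊙S.⊕ y) ⊙S.⊕ y)))
          ⊙S.⊜ (b ⊙S.⊕ a) ⊙S.⊕ (((x ⊙S.⊕ x) ⊙S.⊕ x) ⊙S.⊕ ((y ⊙S.⊕ y) ⊙S.⊕ y))) ⊙.refl

      𝔞𝔠∈Cl3 : Cl3 c (𝔞 · 𝔠)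
      𝔞𝔠∈Cl3 = ·-invertible 𝔞-inv 𝔠-inv , β *K α' , βα'-unit ,
               ≐-trans (cubeI-represents (·-represents ≐-refl ≐-refl)) (≐-of AC³≈[βα'])
        where
        open ⊙-Reasoning
        βα'-unit : IsUnitK (β *K α')
        βα'-unit = []⊙≈𝕆⇒unit (β *K α') ((A' ⊙ C') ³) (begin
          [ β *K α' ] ⊙ (A' ⊙ C') ³       ≈⟨ ⊙.∙-congʳ AC³≈[βα'] ⟨
          (A ⊙ C) ³ ⊙ (A' ⊙ C') ³         ≈⟨ inverse-³ (inverse-∙ AA'≈𝕆 CC'≈𝕆) ⟩
          𝕆                               ∎)

      i : Fin h
      i = proj₁ (classify-Cl3 _ 𝔞𝔠∈Cl3)

      ρ : K
      ρ = proj₁ (proj₂ (classify-Cl3 _ 𝔞𝔠∈Cl3))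

      ρ-unit : IsUnitK ρ
      ρ-unit = proj₁ (proj₂ (proj₂ (classify-Cl3 _ 𝔞𝔠∈Cl3)))

      [ρ]AC≈D : [ ρ ] ⊙ (A ⊙ C) ≈ₛ D i
      [ρ]AC≈D = scale≐⇒[]⊙≈ (·-represents ≐-refl ≐-refl) (proj₂ (proj₂ (proj₂ (classify-Cl3 _ 𝔞𝔠∈Cl3))))

      [ρ]A≈Aᵣ : [ ρ ] ⊙ A ≈ₛ Aᵣ i
      [ρ]A≈Aᵣ = ∙-cancelʳ CC'≈𝕆 (begin
        ([ ρ ] ⊙ A) ⊙ C     ≈⟨ ⊙.assoc [ ρ ] A C ⟩
        [ ρ ] ⊙ (A ⊙ C)     ≈⟨ [ρ]AC≈D ⟩
        D i                 ≈⟨ insertʳ (inverse-comm CC'≈𝕆) (D i) ⟩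
        (D i ⊙ C') ⊙ C      ∎)
        where open ⊙-Reasoning

      [ρ³β]≈[g] : [ cube ρ *K β ] ≈ₛ [ g i ]
      [ρ³β]≈[g] = begin
        [ cube ρ *K β ]                    ≈⟨ ⊙.trans ([]-homo (cube ρ) β) (⊙.∙-congʳ ([]-cube ρ)) ⟩
        [ ρ ] ³ ⊙ [ β ]                    ≈⟨ ⊙.∙-congˡ (⊙.trans ([]-cong β≡βα'α) ([]-homo (β *K α') α)) ⟩
        [ ρ ] ³ ⊙ ([ β *K α' ] ⊙ [ α ])    ≈⟨ ⊙.∙-congˡ (⊙.∙-congʳ AC³≈[βα']) ⟨
        [ ρ ] ³ ⊙ ((A ⊙ C) ³ ⊙ [ α ])      ≈⟨ ⊙.assoc _ _ _ ⟨
        ([ ρ ] ³ ⊙ (A ⊙ C) ³) ⊙ [ α ]      ≈⟨ ⊙.∙-congʳ (³-distrib-∙ [ ρ ] (A ⊙ C)) ⟨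
        ([ ρ ] ⊙ (A ⊙ C)) ³ ⊙ [ α ]        ≈⟨ ⊙.∙-congʳ (³-cong [ρ]AC≈D) ⟩
        D i ³ ⊙ [ α ]                      ≈⟨ [g]≈D³[α] i ⟨
        [ g i ]                            ∎
        where
        open ⊙-Reasoning
        β≡βα'α : β ≡ (β *K α') *K α
        β≡βα'α = K*P.insertʳ (trans (*K-comm α' α) αα'≡1) β

      u : K
      u = (cube ρ *K β) *K g' i

      u∈O* : UnitO c u
      u∈O* = []≈⇒unit-ratio (cube ρ *K β) (g i) (g' i) [ρ³β]≈[g] (gg'≡1 i)

      j : Fin e
      j = proj₁ (classify-O* u u∈O*)

      w : K
      w = proj₁ (proj₂ (classify-O* u u∈O*))

      u≡εw³ : u ≡ ε j *K cube w
      u≡εw³ = proj₂ (proj₂ (proj₂ (classify-O* u u∈O*)))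

      w∈O* : UnitO c w
      w∈O* = proj₁ (proj₂ (proj₂ (classify-O* u u∈O*)))

      v : K
      v = proj₁ (proj₂ w∈O*)

      wv≡1 : w *K v ≡ 1K
      wv≡1 = proj₂ (proj₂ (proj₂ w∈O*))

      v∈O* : UnitO c v
      v∈O* = proj₁ (proj₂ (proj₂ w∈O*)) , w , proj₁ w∈O* , trans (*K-comm v w) wv≡1

      σ : K
      σ = ρ *K v

      σ-unit : IsUnitK σ
      σ-unit = proj₁ ρ-unit *K w ,
               K*.inverse-∙ {ρ} {proj₁ ρ-unit} {v} {w} (proj₂ ρ-unit) (trans (*K-comm v w) wv≡1)

      [σ]A≈Aᵣ : [ σ ] ⊙ A ≈ₛ Aᵣ i
      [σ]A≈Aᵣ = begin
        [ ρ *K v ] ⊙ A        ≈⟨ ⊙.∙-congʳ ([]-homo ρ v) ⟩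
        ([ ρ ] ⊙ [ v ]) ⊙ A   ≈⟨ ⊙.∙-congʳ (elimʳ (unit⇒[]≈𝕆 v∈O*) [ ρ ]) ⟩
        [ ρ ] ⊙ A             ≈⟨ [ρ]A≈Aᵣ ⟩
        Aᵣ i                  ∎
        where open ⊙-Reasoning

      σ³β≡βᵣ : cube σ *K β ≡ βᵣ i j
      σ³β≡βᵣ = begin
        cube (ρ *K v) *K β                     ≡⟨ regroup₁ ρ v β ⟩
        (cube ρ *K β) *K cube v                ≡⟨ cong (_*K cube v) (K*P.insertʳ (g'g≡1 i) (cube ρ *K β)) ⟩
        (u *K g i) *K cube v                   ≡⟨ cong (λ z → (z *K g i) *K cube v) u≡εw³ ⟩
        ((ε j *K cube w) *K g i) *K cube v     ≡⟨ regroup₂ (ε j) w (g i) v ⟩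
        (g i *K ε j) *K cube (w *K v)          ≡⟨ cong (λ z → (g i *K ε j) *K cube z) wv≡1 ⟩
        (g i *K ε j) *K cube 1K                ≡⟨ K*P.elimʳ cube1≡1 (g i *K ε j) ⟩
        g i *K ε j                             ∎
        where
        open ≡-Reasoning
        cube1≡1 : cube 1K ≡ 1K
        cube1≡1 = trans (*K-identityʳ (1K *K 1K)) (*K-identityʳ 1K)
        regroup₁ : ∀ ρ v β → cube (ρ *K v) *K β ≡ (cube ρ *K β) *K cube v
        regroup₁ = KS.solve 3 (λ ρ v β →
          (((ρ KS.⊕ v) KS.⊕ (ρ KS.⊕ v)) KS.⊕ (ρ KS.⊕ v)) KS.⊕ β
          KS.⊜ (((ρ KS.⊕ ρ) KS.⊕ ρ) KS.⊕ β) KS.⊕ ((v KS.⊕ v) KS.⊕ v)) refl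
        regroup₂ : ∀ ε w g v → ((ε *K cube w) *K g) *K cube v ≡ (g *K ε) *K cube (w *K v)
        regroup₂ = KS.solve 4 (λ ε w g v →
          ((ε KS.⊕ ((w KS.⊕ w) KS.⊕ w)) KS.⊕ g) KS.⊕ ((v KS.⊕ v) KS.⊕ v)
          KS.⊜ (g KS.⊕ ε) KS.⊕ (((w KS.⊕ v) KS.⊕ (w KS.⊕ v)) KS.⊕ (w KS.⊕ v))) refl

      classified : Σ (Fin h) λ i → Σ (Fin e) λ j → SEquiv (𝔞 , β) (𝔞ᵣ i , βᵣ i j)
      classified = i , j , σ , σ-unit , ≐-trans ([]⊙≈⇒scale≐ ≐-refl [σ]A≈Aᵣ) (≐-sym (𝔞ᵣ≐Aᵣ i)) , σ³β≡βᵣ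

    class-determined : ∀ {σ i i'} → IsUnitK σ → scale σ (𝔞ᵣ i) ≐ 𝔞ᵣ i' → i ≡ i'
    class-determined {σ} {i} {i'} σ-unit σ𝔞ᵣ≐𝔞ᵣ = 𝔡-distinct i i' (σ , σ-unit , []⊙≈⇒scale≐ ≐-refl [σ]D≈D)
      where
      [σ]Aᵣ≈Aᵣ : [ σ ] ⊙ Aᵣ i ≈ₛ Aᵣ i'
      [σ]Aᵣ≈Aᵣ = scale≐⇒[]⊙≈ (𝔞ᵣ≐Aᵣ i) (≐-trans σ𝔞ᵣ≐𝔞ᵣ (𝔞ᵣ≐Aᵣ i'))
      [σ]D≈D : [ σ ] ⊙ D i ≈ₛ D i'
      [σ]D≈D = ∙-cancelʳ (inverse-comm CC'≈𝕆) (⊙.trans (⊙.assoc [ σ ] (D i) C') [σ]Aᵣ≈Aᵣ)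

    unit-determined : ∀ {σ i i' j j'} → i ≡ i' → scale σ (𝔞ᵣ i) ≐ 𝔞ᵣ i' → cube σ *K βᵣ i j ≡ βᵣ i' j' → j ≡ j'
    unit-determined {σ} {i} {j = j} {j'} refl σ𝔞ᵣ≐𝔞ᵣ σ³β≡β = sym (ε-distinct j' j (σ , σ∈O* , εj'≡εjσ³))
      where
      σ∈O* : UnitO c σ
      σ∈O* = []≈𝕆⇒unit (∙-cancelʳ (Aᵣ-inverse i)
               (⊙.trans (scale≐⇒[]⊙≈ (𝔞ᵣ≐Aᵣ i) (≐-trans σ𝔞ᵣ≐𝔞ᵣ (𝔞ᵣ≐Aᵣ i))) (⊙.sym (⊙.identityˡ (Aᵣ i)))))
      εj'≡εjσ³ : ε j' ≡ ε j *K cube σ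
      εj'≡εjσ³ = begin
        ε j'                                 ≡⟨ K*P.insertˡ {a = g' i} {c = g i} (g'g≡1 i) (ε j') ⟩
        g' i *K (g i *K ε j')                ≡⟨ cong (g' i *K_) σ³β≡β ⟨
        g' i *K (cube σ *K (g i *K ε j))     ≡⟨ regroup (g' i) σ (g i) (ε j) ⟩
        (ε j *K cube σ) *K (g' i *K g i)     ≡⟨ K*P.elimʳ (g'g≡1 i) (ε j *K cube σ) ⟩
        ε j *K cube σ                        ∎
        where
        open ≡-Reasoning
        regroup : ∀ g' σ g ε → g' *K (cube σ *K (g *K ε)) ≡ (ε *K cube σ) *K (g' *K g)
        regroup = KS.solve 4 (λ g' σ g ε →
          g' KS.⊕ (((σ KS.⊕ σ) KS.⊕ σ) KS.⊕ (g KS.⊕ ε))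
          KS.⊜ (ε KS.⊕ ((σ KS.⊕ σ) KS.⊕ σ)) KS.⊕ (g' KS.⊕ g)) refl

    representatives-distinct : ∀ {i j i' j'} → SEquiv (𝔞ᵣ i , βᵣ i j) (𝔞ᵣ i' , βᵣ i' j') → i ≡ i' × j ≡ j'
    representatives-distinct {i} {j} {i'} {j'} (σ , σ-unit , σ𝔞ᵣ≐𝔞ᵣ , σ³β≡β) =
      i≡i' , unit-determined {σ} {i} {i'} {j} {j'} i≡i' σ𝔞ᵣ≐𝔞ᵣ σ³β≡β
      where
      i≡i' : i ≡ i'
      i≡i' = class-determined {σ} {i} {i'} σ-unit σ𝔞ᵣ≐𝔞ᵣ

    fiber-hasCard : HasCard (Fiber b c 𝔟) SEquiv (h * e)
    fiber-hasCard = HasCard-* {P = Fiber b c 𝔟} {R = SEquiv} (λ i j → 𝔞ᵣ i , βᵣ i j) representative∈Fiber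
      (λ { (𝔞 , β) ((𝔞-inv , _) , Φ≐𝔟) → Classification.classified {𝔞} {β} 𝔞-inv Φ≐𝔟 })
      representatives-distinct

open Objects using (InΩ; Fiber; SEquiv; Cl3; ClEq; UnitO; CubeEq)

lemma3p2 : (d : ℤ) → IsFundDisc d → (b c : ℕ) → 1 ≤ b → 1 ≤ c →
    (𝔟 : Pred K 0ℓ) → InΩ d b c 𝔟 →
    (h e : ℕ) → HasCard (Cl3 d c) (ClEq d) h → HasCard (UnitO d c) (CubeEq d c) e →
    HasCard (Fiber d b c 𝔟) (SEquiv d) (h * e)
lemma3p2 d d-fund b c _ _ 𝔟 (𝔟⊆O , (𝔟-frac , _) , 𝔟-norm , 𝔠 , 𝔠-inv , α , (α' , αα'≡1) , 𝔟≐α𝔠³) h e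
  (𝔡 , 𝔡∈Cl3 , classify-Cl3 , 𝔡-distinct) (ε , ε∈O* , classify-O* , ε-distinct) =
  let (T , t≡ιT) = t-integral d-fund in
  Counting.fiber-hasCard d T t≡ιT c b 𝔟 𝔟⊆O 𝔟-frac 𝔟-norm 𝔠 𝔠-inv α α' αα'≡1 𝔟≐α𝔠³
    𝔡 𝔡∈Cl3 classify-Cl3 𝔡-distinct ε ε∈O* classify-O* ε-distinct
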